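{- Let $G$ be a tournament, $w: V(G)\to\mathbb{N}$, and $p\in V(G)$. Let $u,v$ be two vertices such that (i) $\{p,u,v\}$ forms a directed triangle in $G$, and (ii) $w(v)\le w(u)$. Let $w'$ be the weight function defined by $w'(v)=0$, $w'(u)=w(u)-w(v)$, and $w'(x)=w(x)$ for all $x\notin\{u,v\}$. Then for every $2$-approximate $p$-disjoint solution $R_{approx}$ of the instance $(G - v, w')$, the set $R_{approx}\cup\{v\}$ is a $2$-approximate $p$-disjoint solution of $(G,w)$.
   Context: A tournament is a digraph without loops or parallel arcs in which every pair of distinct vertices is joined by exactly one arc. A directed triangle is a directed cycle of length three. A feedback vertex set (FVS) of a digraph $G$ is a set $S\subseteq V(G)$ with $G-S$ acyclic; $w(S)=\sum_{x\in S}w(x)$. For a vertex $p$, an FVS $S$ is $p$-disjoint if $p\notin S$; it is an optimal $p$-disjoint solution of $(G,w)$ if $w(S)\le w(S')$ for every $p$-disjoint FVS $S'$ of $G$; and a $p$-disjoint FVS $S$ is a $2$-approximate $p$-disjoint solution of $(G,w)$ if $w(S)\le 2w(S')$ for an optimal $p$-disjoint solution $S'$ of $(G,w)$. -}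

module Defs where

open import Data.Bool using (Bool; true; false; if_then_else_)
open import Data.Nat using (ℕ; _≤_; _*_; _∸_)
open import Data.Fin using (Fin; _≟_)
open import Data.Fin.Subset using (Subset; _∈_; _∉_; _⊆_; _─_)
open import Data.Fin.Subset.Properties using (_∈?_)
open import Data.List using (List; []; _∷_; _++_; [_]; map; allFin)
open import Data.Nat.ListAction using (sum)
open import Data.List.Relation.Unary.All using (All)
open import Data.List.Relation.Unary.Linked using (Linked)
open import Data.List.Relation.Unary.Unique.Propositional using (Unique)
open import Data.Product using (_×_; ∃)
open import Data.Sum using (_⊎_)
open import Relation.Binary.PropositionalEquality using (_≡_; _≢_)
open import Relation.Nullary using (¬_; does)

Digraph : ℕ → Set
Digraph n = Fin n → Fin n → Bool

Arc : ∀ {n} → Digraph n → Fin n → Fin n → Set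
Arc G x y = G x y ≡ true

IsTournament : ∀ {n} → Digraph n → Set
IsTournament {n} G =
  (∀ x → ¬ Arc G x x) ×
  (∀ (x y : Fin n) → x ≢ y →
     (Arc G x y × ¬ Arc G y x) ⊎ (Arc G y x × ¬ Arc G x y))

DirectedTriangle : ∀ {n} → Digraph n → Fin n → Fin n → Fin n → Set
DirectedTriangle G p u v =
  (Arc G p u × Arc G u v × Arc G v p) ⊎ (Arc G p v × Arc G v u × Arc G u p)

IsDirectedCycle : ∀ {n} → Digraph n → Fin n → List (Fin n) → Set
IsDirectedCycle G x xs = Unique (x ∷ xs) × Linked (Arc G) ((x ∷ xs) ++ [ x ])

AcyclicOn : ∀ {n} → Digraph n → Subset n → Set
AcyclicOn G A = ∀ x xs → All (_∈ A) (x ∷ xs) → ¬ IsDirectedCycle G x xs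

IsFVS : ∀ {n} → Digraph n → Subset n → Subset n → Set
IsFVS G A S = S ⊆ A × AcyclicOn G (A ─ S)

weight : ∀ {n} → (Fin n → ℕ) → Subset n → ℕ
weight {n} w S = sum (map (λ x → if does (x ∈? S) then w x else 0) (allFin n))

IsPDisjointFVS : ∀ {n} → Digraph n → Subset n → Fin n → Subset n → Set
IsPDisjointFVS G A p S = IsFVS G A S × p ∉ S

IsOptimalPDisjoint : ∀ {n} → Digraph n → Subset n → (Fin n → ℕ) → Fin n → Subset n → Set
IsOptimalPDisjoint G A w p S =
  IsPDisjointFVS G A p S × (∀ S' → IsPDisjointFVS G A p S' → weight w S ≤ weight w S')

Is2ApproxPDisjoint : ∀ {n} → Digraph n → Subset n → (Fin n → ℕ) → Fin n → Subset n → Set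
Is2ApproxPDisjoint G A w p S =
  IsPDisjointFVS G A p S ×
  (∀ S' → IsOptimalPDisjoint G A w p S' → weight w S ≤ 2 * weight w S')

reweight : ∀ {n} → (Fin n → ℕ) → Fin n → Fin n → Fin n → ℕ
reweight w u v x =
  if does (x ≟ v) then 0 else (if does (x ≟ u) then w u ∸ w v else w x)

module Submission where

-- With w' the reweighted function and c = w(v), we have the exact pointwise
-- decomposition  w = w' + c·[u] + c·[v]  (using u ≠ v and c ≤ w(u)), where [a]
-- is the point mass at a.  As set weights are additive in the weight function:
--   (upper)  w(R ∪ {v}) ≤ w'(R) + 2c            for every R, since w'(v) = 0;
--   (lower)  w'(S - v) + c ≤ w(S)               whenever u ∈ S or v ∈ S.
-- Every p-disjoint FVS S of G meets {u, v} (as {p,u,v} is a directed triangle)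
-- and S - v is a p-disjoint FVS of G - v, so for an optimum S′ of (G - v, w'):
--   w(R ∪ {v}) ≤ w'(R) + 2c ≤ 2·w'(S′) + 2c ≤ 2(w'(S - v) + c) ≤ 2·w(S).
-- Such an optimum exists only in double-negated form, which suffices because the
-- goal is a decidable inequality.

open import Defs
open import Data.Bool using (if_then_else_)
open import Data.Nat using (ℕ; zero; suc; _≤_; _<_; _+_; _*_; z≤n; _≤?_)
open import Data.Nat.Properties
  using (≤-refl; ≤-reflexive; ≤-trans; ≤-antisym; ≰⇒>; +-mono-≤; +-monoˡ-≤; *-monoʳ-≤; m≤m+n; m≤n+m;
         +-assoc; +-identityʳ; m∸n+n≡m; *-distribˡ-+; module ≤-Reasoning)
open import Data.Nat.Induction using (<-wellFounded)
open import Data.Nat.Tactic.RingSolver using (solve-∀)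
open import Data.Fin as Fin using (Fin; _≟_)
open import Data.Fin.Subset using (Subset; ⊤; ⁅_⁆; _∪_; _─_; _-_; _∈_; _∉_; _⊆_; inside; outside)
open import Data.Fin.Subset.Properties
  using (_∈?_; ∈⊤; x∈⁅x⁆; x∈⁅y⁆⇒x≡y; x∈p∪q⁻; x∈p∪q⁺; p─q⊆p; x∈p∧x∉q⇒x∈p─q; x∈p∧x≢y⇒x∈p-y)
open import Data.Vec using (_∷_; here; there)
open import Data.List using (List; []; _∷_; map; allFin)
open import Data.List.Properties using (map-tabulate)
open import Data.Nat.ListAction using (sum)
open import Data.List.Relation.Unary.All as All using (_∷_; [])
open import Data.List.Relation.Unary.AllPairs using (_∷_; [])
open import Data.List.Relation.Unary.Linked using (_∷_; [-])
open import Data.Product using (Σ; _×_; _,_; proj₁; proj₂)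
open import Data.Sum using (_⊎_; inj₁; inj₂)
open import Data.Empty using (⊥-elim)
open import Function using (_∘_)
open import Induction.WellFounded using (Acc; acc)
open import Relation.Binary.PropositionalEquality using (_≡_; _≢_; refl; sym; trans; cong; subst; module ≡-Reasoning)
open import Relation.Nullary using (¬_; does; yes; no)
open import Relation.Nullary.Decidable using (decidable-stable)

private
  variable
    n : ℕ

sum-map-mono : ∀ {A : Set} (xs : List A) {f g : A → ℕ} → (∀ x → f x ≤ g x) →
  sum (map f xs) ≤ sum (map g xs)
sum-map-mono []       f≤g = z≤n
sum-map-mono (x ∷ xs) f≤g = +-mono-≤ (f≤g x) (sum-map-mono xs f≤g)

sum-map-+ : ∀ {A : Set} (xs : List A) (f g : A → ℕ) →
  sum (map (λ x → f x + g x) xs) ≡ sum (map f xs) + sum (map g xs)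
sum-map-+ []       f g = refl
sum-map-+ (x ∷ xs) f g =
  trans (cong (f x + g x +_) (sum-map-+ xs f g)) (interchange (f x) (g x) _ _)
  where
  interchange : ∀ a b c d → a + b + (c + d) ≡ a + c + (b + d)
  interchange = solve-∀

total : (Fin n → ℕ) → ℕ
total {n} g = sum (map g (allFin n))

total-suc : (g : Fin (suc n) → ℕ) → total g ≡ g Fin.zero + total (g ∘ Fin.suc)
total-suc {n} g =
  cong (g Fin.zero +_) (cong sum (trans (map-tabulate Fin.suc g) (sym (map-tabulate (λ x → x) (g ∘ Fin.suc)))))

total-mono : {g h : Fin n → ℕ} → (∀ x → g x ≤ h x) → total g ≤ total h
total-mono {n} = sum-map-mono (allFin n)

total-cong : {g h : Fin n → ℕ} → (∀ x → g x ≡ h x) → total g ≡ total h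
total-cong g≡h = ≤-antisym (total-mono (≤-reflexive ∘ g≡h)) (total-mono (≤-reflexive ∘ sym ∘ g≡h))

total-+ : (g h : Fin n → ℕ) → total (λ x → g x + h x) ≡ total g + total h
total-+ {n} = sum-map-+ (allFin n)

pointMass : Fin n → ℕ → Fin n → ℕ
pointMass a c x = if does (x ≟ a) then c else 0

total-zero : ∀ n → total {n} (λ _ → 0) ≡ 0
total-zero zero    = refl
total-zero (suc n) = trans (total-suc {n} (λ _ → 0)) (total-zero n)

total-pointMass : (a : Fin n) (c : ℕ) → total (pointMass a c) ≡ c
total-pointMass {suc n} Fin.zero c =
  trans (total-suc {n} (pointMass Fin.zero c)) (trans (cong (c +_) (total-zero n)) (+-identityʳ c))
total-pointMass {suc n} (Fin.suc a) c =
  trans (total-suc (pointMass (Fin.suc a) c)) (total-pointMass a c)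

restrict : Subset n → (Fin n → ℕ) → Fin n → ℕ
restrict S f x = if does (x ∈? S) then f x else 0

restrict-⊤ : (f : Fin n → ℕ) (x : Fin n) → restrict ⊤ f x ≡ f x
restrict-⊤ f x with x ∈? ⊤
... | yes _  = refl
... | no x∉⊤ = ⊥-elim (x∉⊤ ∈⊤)

restrict-⊆ : {S T : Subset n} → S ⊆ T → (f : Fin n → ℕ) (x : Fin n) → restrict S f x ≤ restrict T f x
restrict-⊆ {S = S} {T} S⊆T f x with x ∈? S | x ∈? T
... | yes _   | yes _   = ≤-refl
... | yes x∈S | no  x∉T = ⊥-elim (x∉T (S⊆T x∈S))
... | no  _   | _       = z≤n

restrict-∪ : (S T : Subset n) (f : Fin n → ℕ) (x : Fin n) →
  restrict (S ∪ T) f x ≤ restrict S f x + restrict T f x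
restrict-∪ S T f x with x ∈? (S ∪ T) | x ∈? S | x ∈? T
... | no  _     | _       | _       = z≤n
... | yes _     | yes _   | _       = m≤m+n (f x) _
... | yes _     | no  _   | yes _   = ≤-refl
... | yes x∈S∪T | no  x∉S | no  x∉T with x∈p∪q⁻ S T x∈S∪T
...   | inj₁ x∈S = ⊥-elim (x∉S x∈S)
...   | inj₂ x∈T = ⊥-elim (x∉T x∈T)

restrict-+ : (S : Subset n) (f g : Fin n → ℕ) (x : Fin n) →
  restrict S (λ y → f y + g y) x ≡ restrict S f x + restrict S g x
restrict-+ S f g x with x ∈? S
... | yes _ = refl
... | no  _ = refl

restrict-⁅⁆ : (a : Fin n) (f : Fin n → ℕ) (x : Fin n) → restrict ⁅ a ⁆ f x ≡ pointMass a (f a) x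
restrict-⁅⁆ a f x with x ∈? ⁅ a ⁆ | x ≟ a
... | yes _   | yes refl = refl
... | yes x∈a | no  x≢a  = ⊥-elim (x≢a (x∈⁅y⁆⇒x≡y a x∈a))
... | no  x∉a | yes refl = ⊥-elim (x∉a (x∈⁅x⁆ x))
... | no  _   | no  _    = refl

weight-cong : {f g : Fin n → ℕ} → (∀ x → f x ≡ g x) → (S : Subset n) → weight f S ≡ weight g S
weight-cong f≡g S = total-cong λ x → cong (λ y → if does (x ∈? S) then y else 0) (f≡g x)

weight-⊆ : {S T : Subset n} → S ⊆ T → (f : Fin n → ℕ) → weight f S ≤ weight f T
weight-⊆ S⊆T f = total-mono (restrict-⊆ S⊆T f)

weight-∪ : (S T : Subset n) (f : Fin n → ℕ) → weight f (S ∪ T) ≤ weight f S + weight f T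
weight-∪ S T f = ≤-trans (total-mono (restrict-∪ S T f)) (≤-reflexive (total-+ (restrict S f) (restrict T f)))

weight-+ : (f g : Fin n → ℕ) (S : Subset n) → weight (λ x → f x + g x) S ≡ weight f S + weight g S
weight-+ f g S = trans (total-cong (restrict-+ S f g)) (total-+ (restrict S f) (restrict S g))

weight-⁅⁆ : (f : Fin n → ℕ) (a : Fin n) → weight f ⁅ a ⁆ ≡ f a
weight-⁅⁆ f a = trans (total-cong (restrict-⁅⁆ a f)) (total-pointMass a (f a))

weight-⊤ : (f : Fin n → ℕ) → weight f ⊤ ≡ total f
weight-⊤ f = total-cong (restrict-⊤ f)

weight-pointMass-≤ : (a : Fin n) (c : ℕ) (S : Subset n) → weight (pointMass a c) S ≤ c
weight-pointMass-≤ a c S = begin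
  weight (pointMass a c) S  ≤⟨ weight-⊆ (λ _ → ∈⊤) (pointMass a c) ⟩
  weight (pointMass a c) ⊤  ≡⟨ weight-⊤ (pointMass a c) ⟩
  total (pointMass a c)     ≡⟨ total-pointMass a c ⟩
  c                         ∎
  where open ≤-Reasoning

weight-pointMass-∈ : (a : Fin n) (c : ℕ) {S : Subset n} → a ∈ S → c ≤ weight (pointMass a c) S
weight-pointMass-∈ a c {S} a∈S = begin
  c                              ≡⟨ sym (pointMass-at a c) ⟩
  pointMass a c a                ≡⟨ sym (weight-⁅⁆ (pointMass a c) a) ⟩
  weight (pointMass a c) ⁅ a ⁆  ≤⟨ weight-⊆ ⁅a⁆⊆S (pointMass a c) ⟩
  weight (pointMass a c) S       ∎
  where
  open ≤-Reasoning
  pointMass-at : (a : Fin n) (c : ℕ) → pointMass a c a ≡ c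
  pointMass-at a c with a ≟ a
  ... | yes _   = refl
  ... | no  a≢a = ⊥-elim (a≢a refl)
  ⁅a⁆⊆S : ⁅ a ⁆ ⊆ S
  ⁅a⁆⊆S x∈⁅a⁆ = subst (_∈ S) (sym (x∈⁅y⁆⇒x≡y a x∈⁅a⁆)) a∈S

reweight-split : (w : Fin n → ℕ) (u v : Fin n) → u ≢ v → w v ≤ w u → ∀ x →
  w x ≡ reweight w u v x + pointMass u (w v) x + pointMass v (w v) x
reweight-split w u v u≢v wv≤wu x with x ≟ v | x ≟ u
... | yes refl | yes refl = ⊥-elim (u≢v refl)
... | yes refl | no  _    = refl
... | no  _    | yes refl = sym (trans (+-identityʳ _) (m∸n+n≡m wv≤wu))
... | no  _    | no  _    = sym (trans (+-identityʳ _) (+-identityʳ (w x)))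

reweight-at-v : (w : Fin n → ℕ) (u v : Fin n) → reweight w u v v ≡ 0
reweight-at-v w u v with v ≟ v
... | yes _   = refl
... | no  v≢v = ⊥-elim (v≢v refl)

weight-split : (w : Fin n → ℕ) (u v : Fin n) → u ≢ v → w v ≤ w u → (S : Subset n) →
  weight w S ≡ weight (reweight w u v) S + weight (pointMass u (w v)) S + weight (pointMass v (w v)) S
weight-split w u v u≢v wv≤wu S = begin
  weight w S                                    ≡⟨ weight-cong (reweight-split w u v u≢v wv≤wu) S ⟩
  weight (λ x → w' x + pu x + pv x) S           ≡⟨ weight-+ (λ x → w' x + pu x) pv S ⟩
  weight (λ x → w' x + pu x) S + weight pv S    ≡⟨ cong (_+ weight pv S) (weight-+ w' pu S) ⟩
  weight w' S + weight pu S + weight pv S       ∎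
  where
  open ≡-Reasoning
  w' pu pv : Fin _ → ℕ
  w' = reweight w u v
  pu = pointMass u (w v)
  pv = pointMass v (w v)

weight-∪v-upper : (w : Fin n → ℕ) (u v : Fin n) → u ≢ v → w v ≤ w u → (R : Subset n) →
  weight w (R ∪ ⁅ v ⁆) ≤ weight (reweight w u v) R + 2 * w v
weight-∪v-upper w u v u≢v wv≤wu R = begin
  weight w (R ∪ ⁅ v ⁆)                                   ≡⟨ weight-split w u v u≢v wv≤wu (R ∪ ⁅ v ⁆) ⟩
  weight w' (R ∪ ⁅ v ⁆) + weight pu (R ∪ ⁅ v ⁆) + weight pv (R ∪ ⁅ v ⁆)
    ≤⟨ +-mono-≤ (+-mono-≤ w'-R∪v (weight-pointMass-≤ u (w v) _)) (weight-pointMass-≤ v (w v) _) ⟩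
  weight w' R + w v + w v                                ≡⟨ double (weight w' R) (w v) ⟩
  weight w' R + 2 * w v                                  ∎
  where
  open ≤-Reasoning
  w' pu pv : Fin _ → ℕ
  w' = reweight w u v
  pu = pointMass u (w v)
  pv = pointMass v (w v)
  -- v carries no w'-weight, so adding it to R is free.
  w'-R∪v : weight w' (R ∪ ⁅ v ⁆) ≤ weight w' R
  w'-R∪v = begin
    weight w' (R ∪ ⁅ v ⁆)         ≤⟨ weight-∪ R ⁅ v ⁆ w' ⟩
    weight w' R + weight w' ⁅ v ⁆ ≡⟨ cong (weight w' R +_) (trans (weight-⁅⁆ w' v) (reweight-at-v w u v)) ⟩
    weight w' R + 0               ≡⟨ +-identityʳ _ ⟩
    weight w' R                   ∎
  double : ∀ a b → a + b + b ≡ a + 2 * b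
  double = solve-∀

weight-meets-lower : (w : Fin n → ℕ) (u v : Fin n) → u ≢ v → w v ≤ w u → (S : Subset n) →
  u ∈ S ⊎ v ∈ S → weight (reweight w u v) (S - v) + w v ≤ weight w S
weight-meets-lower w u v u≢v wv≤wu S meets = begin
  weight w' (S - v) + w v                    ≤⟨ +-mono-≤ (weight-⊆ (p─q⊆p S ⁅ v ⁆) w') (pays meets) ⟩
  weight w' S + (weight pu S + weight pv S)  ≡⟨ sym (+-assoc (weight w' S) _ _) ⟩
  weight w' S + weight pu S + weight pv S    ≡⟨ sym (weight-split w u v u≢v wv≤wu S) ⟩
  weight w S                                 ∎
  where
  open ≤-Reasoning
  w' pu pv : Fin _ → ℕ
  w' = reweight w u v
  pu = pointMass u (w v)
  pv = pointMass v (w v)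
  pays : u ∈ S ⊎ v ∈ S → w v ≤ weight pu S + weight pv S
  pays (inj₁ u∈S) = ≤-trans (weight-pointMass-∈ u (w v) u∈S) (m≤m+n _ _)
  pays (inj₂ v∈S) = ≤-trans (weight-pointMass-∈ v (w v) v∈S) (m≤n+m _ _)

∈─⇒∉ : {x : Fin n} (p q : Subset n) → x ∈ p ─ q → x ∉ q
∈─⇒∉ (_ ∷ p) (outside ∷ q) here      ()
∈─⇒∉ (_ ∷ p) (inside  ∷ q) ()        here
∈─⇒∉ (_ ∷ p) (_       ∷ q) (there a) (there b) = ∈─⇒∉ p q a b

∈-⇒≢ : {x y : Fin n} (p : Subset n) → x ∈ p - y → x ≢ y
∈-⇒≢ {y = y} p x∈p-y refl = ∈─⇒∉ p ⁅ y ⁆ x∈p-y (x∈⁅x⁆ y)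

arc-distinct : {G : Digraph n} → IsTournament G → ∀ {x y} → Arc G x y → x ≢ y
arc-distinct (noLoop , _) a refl = noLoop _ a

triangle-distinct : {G : Digraph n} → IsTournament G → ∀ {p u v} →
  DirectedTriangle G p u v → p ≢ v × u ≢ v
triangle-distinct T (inj₁ (_ , uv , vp)) = (λ p≡v → arc-distinct T vp (sym p≡v)) , arc-distinct T uv
triangle-distinct T (inj₂ (pv , vu , _)) = arc-distinct T pv , λ u≡v → arc-distinct T vu (sym u≡v)

acyclic-⊆ : {G : Digraph n} {A B : Subset n} → A ⊆ B → AcyclicOn G B → AcyclicOn G A
acyclic-⊆ A⊆B acyclicB x xs inA = acyclicB x xs (All.map A⊆B inA)

acyclic-no-triangle : {G : Digraph n} → IsTournament G → {A : Subset n} → AcyclicOn G A →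
  ∀ {a b c} → a ∈ A → b ∈ A → c ∈ A → ¬ (Arc G a b × Arc G b c × Arc G c a)
acyclic-no-triangle T acyclic {a} {b} {c} a∈A b∈A c∈A (ab , bc , ca) =
  acyclic _ (_ ∷ _ ∷ []) (a∈A ∷ b∈A ∷ c∈A ∷ [])
    ( ((a≢b ∷ a≢c ∷ []) ∷ (arc-distinct T bc ∷ []) ∷ [] ∷ [])
    , (ab ∷ bc ∷ ca ∷ [-]) )
  where
  a≢b : a ≢ b
  a≢b = arc-distinct T ab
  a≢c : a ≢ c
  a≢c = λ a≡c → arc-distinct T ca (sym a≡c)

fvs-meets-triangle : {G : Digraph n} → IsTournament G → ∀ {A S p u v} → IsFVS G A S →
  p ∈ A → u ∈ A → v ∈ A → p ∉ S → DirectedTriangle G p u v → u ∈ S ⊎ v ∈ S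
fvs-meets-triangle {G = G} T {A} {S} {p} {u} {v} (_ , acyclic) p∈A u∈A v∈A p∉S triangle
  with u ∈? S | v ∈? S
... | yes u∈S | _       = inj₁ u∈S
... | no  _   | yes v∈S = inj₂ v∈S
... | no  u∉S | no  v∉S = ⊥-elim (no-triangle triangle)
  where
  outside-S : ∀ {x} → x ∈ A → x ∉ S → x ∈ A ─ S
  outside-S = x∈p∧x∉q⇒x∈p─q
  p∈ : p ∈ A ─ S
  p∈ = outside-S p∈A p∉S
  u∈ : u ∈ A ─ S
  u∈ = outside-S u∈A u∉S
  v∈ : v ∈ A ─ S
  v∈ = outside-S v∈A v∉S
  no-triangle : ¬ DirectedTriangle G p u v
  no-triangle (inj₁ puv) = acyclic-no-triangle T acyclic p∈ u∈ v∈ puv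
  no-triangle (inj₂ pvu) = acyclic-no-triangle T acyclic p∈ v∈ u∈ pvu

pdisjoint-delete : {G : Digraph n} {A S : Subset n} {p : Fin n} (v : Fin n) →
  IsPDisjointFVS G A p S → IsPDisjointFVS G (A - v) p (S - v)
pdisjoint-delete {A = A} {S} v ((S⊆A , acyclic) , p∉S) =
  ((λ x∈S-v → x∈p∧x≢y⇒x∈p-y (S⊆A (p─q⊆p S ⁅ v ⁆ x∈S-v)) (∈-⇒≢ S x∈S-v)) , acyclic-⊆ shrink acyclic)
  , λ p∈S-v → p∉S (p─q⊆p S ⁅ v ⁆ p∈S-v)
  where
  shrink : (A - v) ─ (S - v) ⊆ A ─ S
  shrink x∈ = x∈p∧x∉q⇒x∈p─q (p─q⊆p A ⁅ v ⁆ x∈A-v)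
    (λ x∈S → ∈─⇒∉ (A - v) (S - v) x∈ (x∈p∧x≢y⇒x∈p-y x∈S (∈-⇒≢ A x∈A-v)))
    where
    x∈A-v : _ ∈ A - v
    x∈A-v = p─q⊆p (A - v) (S - v) x∈

pdisjoint-add : {G : Digraph n} {A R : Subset n} {p v : Fin n} → v ∈ A → p ≢ v →
  IsPDisjointFVS G (A - v) p R → IsPDisjointFVS G A p (R ∪ ⁅ v ⁆)
pdisjoint-add {A = A} {R} {p} {v} v∈A p≢v ((R⊆A-v , acyclic) , p∉R) =
  (R∪v⊆A , acyclic-⊆ shrink acyclic) , p∉R∪v
  where
  R∪v⊆A : R ∪ ⁅ v ⁆ ⊆ A
  R∪v⊆A x∈ with x∈p∪q⁻ R ⁅ v ⁆ x∈
  ... | inj₁ x∈R = p─q⊆p A ⁅ v ⁆ (R⊆A-v x∈R)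
  ... | inj₂ x∈v with x∈⁅y⁆⇒x≡y v x∈v
  ...   | refl = v∈A
  shrink : A ─ (R ∪ ⁅ v ⁆) ⊆ (A - v) ─ R
  shrink x∈ = x∈p∧x∉q⇒x∈p─q (x∈p∧x≢y⇒x∈p-y (p─q⊆p A _ x∈) (λ { refl → x∉R∪v (x∈p∪q⁺ (inj₂ (x∈⁅x⁆ v))) }))
                              (λ x∈R → x∉R∪v (x∈p∪q⁺ (inj₁ x∈R)))
    where
    x∉R∪v : _ ∉ R ∪ ⁅ v ⁆
    x∉R∪v = ∈─⇒∉ A (R ∪ ⁅ v ⁆) x∈
  p∉R∪v : p ∉ R ∪ ⁅ v ⁆
  p∉R∪v p∈ with x∈p∪q⁻ R ⁅ v ⁆ p∈
  ... | inj₁ p∈R = p∉R p∈R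
  ... | inj₂ p∈v = p≢v (x∈⁅y⁆⇒x≡y v p∈v)

IsMinimum : {A : Set} → (A → Set) → (A → ℕ) → A → Set
IsMinimum {A} P f S = P S × (∀ S′ → P S′ → f S ≤ f S′)

-- If P is inhabited then, classically, f has a minimiser on P.  Proof by
-- well-founded induction on f: a non-minimal T has a P-witness of smaller value.
¬¬-minimum : {A : Set} (P : A → Set) (f : A → ℕ) {T : A} → P T → ¬ ¬ Σ A (IsMinimum P f)
¬¬-minimum {A} P f {T} PT = descend T PT (<-wellFounded (f T))
  where
  descend : ∀ T → P T → Acc _<_ (f T) → ¬ ¬ Σ A (IsMinimum P f)
  descend T PT (acc smaller) noMinimum = noMinimum (T , PT , T-minimal)
    where
    T-minimal : ∀ S → P S → f T ≤ f S
    T-minimal S PS with f T ≤? f S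
    ... | yes fT≤fS = fT≤fS
    ... | no  fT≰fS = ⊥-elim (descend S PS (smaller (≰⇒> fT≰fS)) noMinimum)

lemma4 : ∀ {n} (G : Digraph n) → IsTournament G →
    (w : Fin n → ℕ) (p u v : Fin n) →
    DirectedTriangle G p u v → w v ≤ w u →
    (R : Subset n) → Is2ApproxPDisjoint G (⊤ - v) (reweight w u v) p R →
    Is2ApproxPDisjoint G ⊤ w p (R ∪ ⁅ v ⁆)
lemma4 G T w p u v triangle wv≤wu R (R-feasible , R-approx) =
  pdisjoint-add ∈⊤ p≢v R-feasible , bound
  where
  p≢v : p ≢ v
  p≢v = proj₁ (triangle-distinct T triangle)
  u≢v : u ≢ v
  u≢v = proj₂ (triangle-distinct T triangle)
  w' : Fin _ → ℕ
  w' = reweight w u v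

  -- Given an optimum S′ of (G - v, w'), compare against the feasible set S - v.
  chain : ∀ S → IsOptimalPDisjoint G ⊤ w p S → ∀ S′ → IsOptimalPDisjoint G (⊤ - v) w' p S′ →
    weight w (R ∪ ⁅ v ⁆) ≤ 2 * weight w S
  chain S (S-feasible , _) S′ S′-optimal@(_ , S′-minimal) = begin
    weight w (R ∪ ⁅ v ⁆)            ≤⟨ weight-∪v-upper w u v u≢v wv≤wu R ⟩
    weight w' R + 2 * w v           ≤⟨ +-monoˡ-≤ _ (R-approx S′ S′-optimal) ⟩
    2 * weight w' S′ + 2 * w v      ≤⟨ +-monoˡ-≤ _ (*-monoʳ-≤ 2 (S′-minimal (S - v) S-v-feasible)) ⟩
    2 * weight w' (S - v) + 2 * w v ≡⟨ sym (*-distribˡ-+ 2 (weight w' (S - v)) (w v)) ⟩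
    2 * (weight w' (S - v) + w v)   ≤⟨ *-monoʳ-≤ 2 (weight-meets-lower w u v u≢v wv≤wu S meets) ⟩
    2 * weight w S                  ∎
    where
    open ≤-Reasoning
    S-v-feasible : IsPDisjointFVS G (⊤ - v) p (S - v)
    S-v-feasible = pdisjoint-delete v S-feasible
    meets : u ∈ S ⊎ v ∈ S
    meets = fvs-meets-triangle T (proj₁ S-feasible) ∈⊤ ∈⊤ ∈⊤ (proj₂ S-feasible) triangle

  bound : ∀ S → IsOptimalPDisjoint G ⊤ w p S → weight w (R ∪ ⁅ v ⁆) ≤ 2 * weight w S
  bound S S-optimal = decidable-stable (_ ≤? _) λ fails →
    ¬¬-minimum (IsPDisjointFVS G (⊤ - v) p) (weight w') (pdisjoint-delete v (proj₁ S-optimal))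
      λ { (S′ , S′-optimal) → fails (chain S S-optimal S′ S′-optimal) }
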